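{- Let $R$ be a principal ideal domain, let $\mathfrak p=(\pi)$ be a prime ideal of $R$ with finite residue field $R/\mathfrak p$, let $C_{\mathfrak p}$ be a complete system of distinct representatives for $R/\mathfrak p$, and let $f(x)\in R[x]$. Define \[S_{f,\mathfrak p}=\{a\in C_{\mathfrak p}\mid \exists b\in R,\ f(b)\equiv a \bmod \mathfrak p,\ f'(b)\not\equiv 0 \bmod \mathfrak p\},\] \[S_{f,\mathfrak p}^-=\{a\in C_{\mathfrak p}\mid \exists b\in R,\ f(b)\equiv a \bmod \mathfrak p,\ f'(b)\equiv 0 \bmod \mathfrak p\}.\] Then \[\overline{f(R)}^{\mathfrak p}=\bigsqcup_{a\in S_{f,\mathfrak p}}(a+\mathfrak p)\ \sqcup\ E,\] where $E=\overline{f(R)}^{\mathfrak p}\setminus \bigsqcup_{a\in S_{f,\mathfrak p}}(a+\mathfrak p)$ satisfies \[E\subset\bigsqcup_{a\in S_{f,\mathfrak p}^-\setminus S_{f,\mathfrak p}}\ \bigcup_{\substack{b\in C_{\mathfrak p}\\ f(b)\equiv a \bmod \mathfrak p}}\bigl(f(b)+\mathfrak p^{2}\bigr).\]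
   Context: For a subset $S\subset R$, the $\mathfrak p$-adic closure $\overline{S}^{\mathfrak p}$ of $S$ in $R$ is the set of all $x\in R$ such that for every positive integer $k$ there exists $s\in S$ with $x\equiv s \pmod{\mathfrak p^k}$. $f'$ is the formal derivative of $f$. -}

module Defs where

open import Level using (Level; _⊔_) renaming (suc to lsuc)
open import Algebra.Bundles using (CommutativeRing; Semiring)
open import Data.Nat using (ℕ; zero; suc; _≤_)
open import Data.Fin using (Fin)
open import Data.List using (List; []; _∷_)
open import Data.Product using (Σ; ∃; _×_; _,_)
open import Data.Sum using (_⊎_)
open import Relation.Nullary using (¬_)
open import Relation.Binary.PropositionalEquality using (_≡_)

module _ {c ℓ : Level} (R : CommutativeRing c ℓ) where
  open CommutativeRing R
  open import Algebra.Definitions.RawSemiring (Semiring.rawSemiring semiring) using (_∣_; _^_) renaming (_×_ to _·_)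

  record IsIdeal (I : Carrier → Set (c ⊔ ℓ)) : Set (c ⊔ ℓ) where
    field
      resp     : ∀ {x y} → x ≈ y → I x → I y
      zero∈    : I 0#
      +-closed : ∀ {x y} → I x → I y → I (x + y)
      *-closed : ∀ r {x} → I x → I (r * x)

  record IsPID : Set (lsuc (c ⊔ ℓ)) where
    field
      1≉0       : ¬ (1# ≈ 0#)
      noZeroDiv : ∀ {x y} → (x * y) ≈ 0# → (x ≈ 0#) ⊎ (y ≈ 0#)
      principal : ∀ (I : Carrier → Set (c ⊔ ℓ)) → IsIdeal I →
                  ∃ λ g → ∀ x → (I x → g ∣ x) × (g ∣ x → I x)

  record GeneratesPrimeIdeal (π : Carrier) : Set (c ⊔ ℓ) where
    field
      proper : ¬ (π ∣ 1#)
      split  : ∀ {x y} → π ∣ (x * y) → (π ∣ x) ⊎ (π ∣ y)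

  Cong : Carrier → Carrier → Carrier → Set (c ⊔ ℓ)
  Cong x y m = m ∣ (x - y)

  record IsCompleteRepSystem (π : Carrier) {q : ℕ} (C : Fin q → Carrier) : Set (c ⊔ ℓ) where
    field
      complete : ∀ x → Σ (Fin q) λ i → Cong x (C i) π
      distinct : ∀ i j → Cong (C i) (C j) π → i ≡ j

  -- polynomials in R[x] as lists of coefficients, constant term first
  Poly : Set c
  Poly = List Carrier

  eval : Poly → Carrier → Carrier
  eval []       x = 0#
  eval (a ∷ as) x = a + x * eval as x

  derivFrom : ℕ → Poly → Poly
  derivFrom n []       = []
  derivFrom n (a ∷ as) = (n · a) ∷ derivFrom (suc n) as

  deriv : Poly → Poly
  deriv []       = []
  deriv (a ∷ as) = derivFrom 1 as

  module Setup (π : Carrier) {q : ℕ} (C : Fin q → Carrier) (f : Poly) where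

    InClosure : Carrier → Set (c ⊔ ℓ)
    InClosure x = ∀ (k : ℕ) → 1 ≤ k → ∃ λ s → Cong x (eval f s) (π ^ k)

    InS : Fin q → Set (c ⊔ ℓ)
    InS i = ∃ λ b → Cong (eval f b) (C i) π × ¬ Cong (eval (deriv f) b) 0# π

    InS⁻ : Fin q → Set (c ⊔ ℓ)
    InS⁻ i = ∃ λ b → Cong (eval f b) (C i) π × Cong (eval (deriv f) b) 0# π

    InSPart : Carrier → Set (c ⊔ ℓ)
    InSPart x = ∃ λ i → InS i × Cong x (C i) π

    InE : Carrier → Set (c ⊔ ℓ)
    InE x = InClosure x × ¬ InSPart x

    InBlock : Fin q → Carrier → Set (c ⊔ ℓ)
    InBlock i x = ∃ λ j → Cong (eval f (C j)) (C i) π × Cong x (eval f (C j)) (π ^ 2)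

-- Newton's iteration is Hensel's lemma: if f(b) ≡ a and e f′(b) ≡ 1 modulo π, and x ≡ a, then
-- from x ≡ f(s) modulo πᵏ⁺¹ the first-order Taylor expansion of f at s shows that s + (x − f(s)) e
-- satisfies the congruence modulo πᵏ⁺²; and π ∤ f′(b) gives such an e because (π, f′(b)) = (1)
-- in a PID (unless π = 0, when the congruences are equalities and b already works). So every
-- class a + p with a ∈ S lies in the closure. Conversely, an x in the closure outside these
-- classes is f(s) modulo π² for some s with π ∣ f′(s), and the same expansion at the
-- representative b of s gives f(s) ≡ f(b) modulo π². Both disjointness claims are uniqueness of
-- representatives modulo π.
{-# OPTIONS --safe #-}
module Submission where

open import Defs
open import Level using (Level; _⊔_)
open import Algebra.Bundles using (CommutativeRing; Semiring)
open import Data.Nat using (ℕ)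
open import Data.Fin using (Fin)
open import Data.Product using (∃; _×_)
open import Relation.Nullary using (¬_)
open import Relation.Binary.PropositionalEquality using (_≡_)

open import Algebra.Solver.Ring.AlmostCommutativeRing
  using (_-Raw-AlmostCommutative⟶_; fromCommutativeRing)
open import Data.Empty using (⊥-elim)
open import Data.Fin.Properties using () renaming (_≟_ to _≟ᶠ_)
open import Data.Integer as ℤ using (ℤ; +_; -[1+_]; _⊖_; _◃_; sign; ∣_∣)
import Data.Integer.Properties as ℤ
open import Data.List using ([]; _∷_)
open import Data.Maybe using (Maybe; just; nothing)
import Data.Nat as ℕ
import Data.Nat.Properties as ℕ
open import Data.Product using (∃₂; _,_; proj₁; proj₂)
open import Data.Sign as Sign using (Sign)
open import Data.Sum using (_⊎_; inj₁; inj₂)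
open import Relation.Nullary using (Dec; yes; no)
import Relation.Binary.PropositionalEquality as ≡

-- The ring solver normalises coefficients only when it can decide their equality, so the
-- coefficients are taken in ℤ and interpreted in R along the canonical morphism ℤ → R.
-- As con (+ 1) denotes 1# + 0#, a literal 1# is passed to solve as a variable.
module IntegerCoefficientSolver {c ℓ : Level} (R : CommutativeRing c ℓ) where
  open CommutativeRing R
  open import Algebra.Properties.Ring ring using (-1*x≈-x; -‿distribˡ-*)
  open import Algebra.Properties.AbelianGroup +-abelianGroup using (⁻¹-∙-comm)
  open import Algebra.Properties.Group +-group using (ε⁻¹≈ε; ⁻¹-involutive)
  open import Algebra.Properties.CommutativeSemigroup *-commutativeSemigroup using (interchange)
  open import Algebra.Properties.Semiring.Mult semiring using (×-homo-+; ×1-homo-*)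
  open import Algebra.Definitions.RawSemiring (Semiring.rawSemiring semiring) using () renaming (_×_ to _·_)
  open import Relation.Binary.Reasoning.Setoid setoid

  ℤ→R : ℤ → Carrier
  ℤ→R (+ n)    = n · 1#
  ℤ→R -[1+ n ] = - (ℕ.suc n · 1#)

  ℤ→R-⊖ : ∀ m n → ℤ→R (m ⊖ n) ≈ m · 1# - n · 1#
  ℤ→R-⊖ m ℕ.zero = begin
    ℤ→R (m ⊖ 0)  ≡⟨ ≡.cong ℤ→R (ℤ.≤-⊖ {m = 0} {n = m} ℕ.z≤n) ⟩
    m · 1#       ≈⟨ sym (+-identityʳ _) ⟩
    m · 1# + 0#  ≈⟨ +-congˡ (sym ε⁻¹≈ε) ⟩
    m · 1# - 0#  ∎
  ℤ→R-⊖ ℕ.zero    (ℕ.suc n) = sym (+-identityˡ _)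
  ℤ→R-⊖ (ℕ.suc m) (ℕ.suc n) = begin
    ℤ→R (ℕ.suc m ⊖ ℕ.suc n)                   ≡⟨ ≡.cong ℤ→R (ℤ.[1+m]⊖[1+n]≡m⊖n m n) ⟩
    ℤ→R (m ⊖ n)                               ≈⟨ ℤ→R-⊖ m n ⟩
    m · 1# - n · 1#                           ≈⟨ x-y≈[a+x]-[a+y] 1# (m · 1#) (n · 1#) ⟩
    (1# + m · 1#) - (1# + n · 1#)             ∎
    where
    x-y≈[a+x]-[a+y] : ∀ a x y → x - y ≈ (a + x) - (a + y)
    x-y≈[a+x]-[a+y] a x y = begin
      x - y                    ≈⟨ sym (+-identityˡ _) ⟩
      0# + (x - y)             ≈⟨ +-congʳ (sym (-‿inverseʳ a)) ⟩
      (a - a) + (x - y)        ≈⟨ +-assoc a (- a) (x - y) ⟩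
      a + (- a + (x - y))      ≈⟨ +-congˡ (sym (+-assoc (- a) x (- y))) ⟩
      a + ((- a + x) - y)      ≈⟨ +-congˡ (+-congʳ (+-comm (- a) x)) ⟩
      a + ((x - a) - y)        ≈⟨ +-congˡ (+-assoc x (- a) (- y)) ⟩
      a + (x + (- a - y))      ≈⟨ sym (+-assoc a x _) ⟩
      (a + x) + (- a - y)      ≈⟨ +-congˡ (⁻¹-∙-comm a y) ⟩
      (a + x) - (a + y)        ∎

  signToR : Sign → Carrier
  signToR Sign.+ = 1#
  signToR Sign.- = - 1#

  signToR-* : ∀ s t → signToR (s Sign.* t) ≈ signToR s * signToR t
  signToR-* Sign.+ Sign.+ = sym (*-identityˡ _)
  signToR-* Sign.+ Sign.- = sym (*-identityˡ _)
  signToR-* Sign.- Sign.+ = sym (*-identityʳ _)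
  signToR-* Sign.- Sign.- = begin
    1#             ≈⟨ sym (⁻¹-involutive 1#) ⟩
    - (- 1#)       ≈⟨ -‿cong (sym (-1*x≈-x 1#)) ⟩
    - (- 1# * 1#)  ≈⟨ -‿cong (*-comm (- 1#) 1#) ⟩
    - (1# * - 1#)  ≈⟨ -‿distribˡ-* 1# (- 1#) ⟩
    - 1# * - 1#    ∎

  ℤ→R-◃ : ∀ s n → ℤ→R (s ◃ n) ≈ signToR s * (n · 1#)
  ℤ→R-◃ s        ℕ.zero    = sym (zeroʳ _)
  ℤ→R-◃ Sign.+ (ℕ.suc n) = sym (*-identityˡ _)
  ℤ→R-◃ Sign.- (ℕ.suc n) = sym (-1*x≈-x _)

  ℤ→R-signAbs : ∀ i → ℤ→R i ≈ signToR (sign i) * (∣ i ∣ · 1#)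
  ℤ→R-signAbs i = begin
    ℤ→R i                 ≡⟨ ≡.cong ℤ→R (≡.sym (ℤ.◃-inverse i)) ⟩
    ℤ→R (sign i ◃ ∣ i ∣)  ≈⟨ ℤ→R-◃ (sign i) ∣ i ∣ ⟩
    signToR (sign i) * (∣ i ∣ · 1#) ∎

  ℤ→R-+ : ∀ i j → ℤ→R (i ℤ.+ j) ≈ ℤ→R i + ℤ→R j
  ℤ→R-+ (+ m)    (+ n)    = ×-homo-+ 1# m n
  ℤ→R-+ (+ m)    -[1+ n ] = ℤ→R-⊖ m (ℕ.suc n)
  ℤ→R-+ -[1+ m ] (+ n)    = trans (ℤ→R-⊖ n (ℕ.suc m)) (+-comm _ _)
  ℤ→R-+ -[1+ m ] -[1+ n ] = begin
    - (ℕ.suc (ℕ.suc (m ℕ.+ n)) · 1#)        ≡⟨ ≡.cong (λ k → - (ℕ.suc k · 1#)) (≡.sym (ℕ.+-suc m n)) ⟩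
    - ((ℕ.suc m ℕ.+ ℕ.suc n) · 1#)          ≈⟨ -‿cong (×-homo-+ 1# (ℕ.suc m) (ℕ.suc n)) ⟩
    - (ℕ.suc m · 1# + ℕ.suc n · 1#)         ≈⟨ sym (⁻¹-∙-comm _ _) ⟩
    - (ℕ.suc m · 1#) + - (ℕ.suc n · 1#)     ∎

  ℤ→R-* : ∀ i j → ℤ→R (i ℤ.* j) ≈ ℤ→R i * ℤ→R j
  ℤ→R-* i j = begin
    ℤ→R (i ℤ.* j)
      ≈⟨ ℤ→R-◃ (sign i Sign.* sign j) (∣ i ∣ ℕ.* ∣ j ∣) ⟩
    signToR (sign i Sign.* sign j) * ((∣ i ∣ ℕ.* ∣ j ∣) · 1#)
      ≈⟨ *-cong (signToR-* (sign i) (sign j)) (×1-homo-* ∣ i ∣ ∣ j ∣) ⟩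
    (signToR (sign i) * signToR (sign j)) * ((∣ i ∣ · 1#) * (∣ j ∣ · 1#))
      ≈⟨ interchange _ _ _ _ ⟩
    (signToR (sign i) * (∣ i ∣ · 1#)) * (signToR (sign j) * (∣ j ∣ · 1#))
      ≈⟨ sym (*-cong (ℤ→R-signAbs i) (ℤ→R-signAbs j)) ⟩
    ℤ→R i * ℤ→R j ∎

  ℤ→R-- : ∀ i → ℤ→R (ℤ.- i) ≈ - ℤ→R i
  ℤ→R-- -[1+ n ]      = sym (⁻¹-involutive _)
  ℤ→R-- (+ ℕ.zero)    = sym ε⁻¹≈ε
  ℤ→R-- (+ ℕ.suc n)   = refl

  ℤ→R-morphism : ℤ.+-*-rawRing -Raw-AlmostCommutative⟶ fromCommutativeRing R
  ℤ→R-morphism = record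
    { ⟦_⟧    = ℤ→R
    ; +-homo = ℤ→R-+
    ; *-homo = ℤ→R-*
    ; -‿homo = ℤ→R--
    ; 0-homo = refl
    ; 1-homo = +-identityʳ 1#
    }

  ℤ→R-≟ : ∀ i j → Maybe (ℤ→R i ≈ ℤ→R j)
  ℤ→R-≟ i j with i ℤ.≟ j
  ... | yes ≡.refl = just refl
  ... | no _     = nothing

  open import Algebra.Solver.Ring ℤ.+-*-rawRing (fromCommutativeRing R) ℤ→R-morphism ℤ→R-≟ public

module CongruenceProperties {c ℓ : Level} (R : CommutativeRing c ℓ) where
  open CommutativeRing R
  open import Algebra.Definitions.RawSemiring (Semiring.rawSemiring semiring)
    using (_∣_; _^_) renaming (_×_ to _·_)
  open import Algebra.Properties.Ring ring using (-‿distribˡ-*)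
  open import Algebra.Properties.Semiring.Divisibility semiring
    using (_,_; _∣0; ∣ʳ-trans; ∣ʳ-respʳ-≈; ∣ʳ-respˡ-≈; x∣ʳy⇒x∣ʳzy; x∣ʳy⇒xz∣ʳyz; 0∣x⇒x≈0)
  open import Algebra.Properties.Semiring.Mult semiring using (×-assoc-*; ×-congʳ)
  open import Relation.Binary.Reasoning.Setoid setoid
  open IntegerCoefficientSolver R using (solve; _:=_; _:+_; _:-_; _:*_; :-_; con)

  ∣x∣y⇒∣x+y : ∀ {m x y} → m ∣ x → m ∣ y → m ∣ x + y
  ∣x∣y⇒∣x+y {m} (p , pm≈x) (q , qm≈y) = p + q , trans (distribʳ m p q) (+-cong pm≈x qm≈y)

  ∣x⇒∣-x : ∀ {m x} → m ∣ x → m ∣ - x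
  ∣x⇒∣-x {m} (p , pm≈x) = - p , trans (sym (-‿distribˡ-* p m)) (-‿cong pm≈x)

  ∣x∣y⇒∣x-y : ∀ {m x y} → m ∣ x → m ∣ y → m ∣ x - y
  ∣x∣y⇒∣x-y m∣x m∣y = ∣x∣y⇒∣x+y m∣x (∣x⇒∣-x m∣y)

  ∣x⇒∣xy : ∀ {m x} y → m ∣ x → m ∣ x * y
  ∣x⇒∣xy {x = x} y m∣x = ∣ʳ-respʳ-≈ (*-comm y x) (x∣ʳy⇒x∣ʳzy y m∣x)

  x∣x^[1+k] : ∀ x k → x ∣ x ^ ℕ.suc k
  x∣x^[1+k] x k = x ^ k , *-comm (x ^ k) x

  x∣a∧y∣b⇒xy∣ab : ∀ {x y a b} → x ∣ a → y ∣ b → x * y ∣ a * b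
  x∣a∧y∣b⇒xy∣ab {x} {y} {a} {b} (p , px≈a) (q , qy≈b) = p * q , (begin
    (p * q) * (x * y)  ≈⟨ solve 4 (λ p q x y → (p :* q) :* (x :* y) := (p :* x) :* (q :* y)) refl p q x y ⟩
    (p * x) * (q * y)  ≈⟨ *-cong px≈a qy≈b ⟩
    a * b              ∎)

  x-0≈x : ∀ x → x - 0# ≈ x
  x-0≈x x = solve 1 (λ x → x :- con (+ 0) := x) refl x

  ∣⇒Cong-0 : ∀ {m x} → m ∣ x → Cong R x 0# m
  ∣⇒Cong-0 {x = x} = ∣ʳ-respʳ-≈ (sym (x-0≈x x))

  Cong-0⇒∣ : ∀ {m x} → Cong R x 0# m → m ∣ x
  Cong-0⇒∣ {x = x} = ∣ʳ-respʳ-≈ (x-0≈x x)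

  Cong-refl : ∀ {m x} → Cong R x x m
  Cong-refl {m} {x} = ∣ʳ-respʳ-≈ (sym (-‿inverseʳ x)) (m ∣0)

  Cong-sym : ∀ {m x y} → Cong R x y m → Cong R y x m
  Cong-sym {x = x} {y} m∣x-y = ∣ʳ-respʳ-≈ (solve 2 (λ x y → :- (x :- y) := y :- x) refl x y) (∣x⇒∣-x m∣x-y)

  Cong-trans : ∀ {m x y z} → Cong R x y m → Cong R y z m → Cong R x z m
  Cong-trans {x = x} {y} {z} m∣x-y m∣y-z =
    ∣ʳ-respʳ-≈ (solve 3 (λ x y z → (x :- y) :+ (y :- z) := x :- z) refl x y z) (∣x∣y⇒∣x+y m∣x-y m∣y-z)

  Cong-*ˡ : ∀ {m x y} a → Cong R x y m → Cong R (a * x) (a * y) m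
  Cong-*ˡ {x = x} {y} a m∣x-y =
    ∣ʳ-respʳ-≈ (solve 3 (λ a x y → a :* (x :- y) := a :* x :- a :* y) refl a x y) (x∣ʳy⇒x∣ʳzy a m∣x-y)

  Cong-^⇒Cong : ∀ {m x y} k → Cong R x y (m ^ ℕ.suc k) → Cong R x y m
  Cong-^⇒Cong {m} k = ∣ʳ-trans (x∣x^[1+k] m k)

  Cong-modulus≈0 : ∀ {m x y} n → m ≈ 0# → Cong R x y m → Cong R x y n
  Cong-modulus≈0 {m} {x} {y} n m≈0 m∣x-y = ∣ʳ-respʳ-≈ (sym x-y≈0) (n ∣0)
    where
    x-y≈0 : x - y ≈ 0#
    x-y≈0 = 0∣x⇒x≈0 (∣ʳ-respˡ-≈ m≈0 m∣x-y)

  eval-cong : ∀ f {x y} → x ≈ y → eval R f x ≈ eval R f y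
  eval-cong []      x≈y = refl
  eval-cong (a ∷ f) x≈y = +-congˡ (*-cong x≈y (eval-cong f x≈y))

  ·-homo-* : ∀ n a → n · a ≈ (n · 1#) * a
  ·-homo-* n a = sym (trans (×-assoc-* n 1# a) (×-congʳ n (*-identityˡ a)))

  eval-derivFrom : ∀ n f x →
    eval R (derivFrom R n f) x ≈ (n · 1#) * eval R f x + x * eval R (deriv R f) x
  eval-derivFrom n []      x = solve 2 (λ n x → con (+ 0) := n :* con (+ 0) :+ x :* con (+ 0)) refl (n · 1#) x
  eval-derivFrom n (a ∷ f) x = begin
    n · a + x * eval R (derivFrom R (ℕ.suc n) f) x
      ≈⟨ +-cong (·-homo-* n a) (*-congˡ (eval-derivFrom (ℕ.suc n) f x)) ⟩
    (n · 1#) * a + x * ((1# + n · 1#) * F + x * D)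
      ≈⟨ solve 6 (λ n a x F D o → n :* a :+ x :* ((o :+ n) :* F :+ x :* D)
                                := n :* (a :+ x :* F) :+ x :* ((o :+ con (+ 0)) :* F :+ x :* D))
               refl (n · 1#) a x F D 1# ⟩
    (n · 1#) * (a + x * F) + x * ((1# + 0#) * F + x * D)
      ≈⟨ +-congˡ (*-congˡ (sym (eval-derivFrom 1 f x))) ⟩
    (n · 1#) * (a + x * F) + x * eval R (derivFrom R 1 f) x ∎
    where
    F = eval R f x
    D = eval R (deriv R f) x

  eval-taylor : ∀ f s h → ∃ λ T →
    eval R f (s + h) ≈ (eval R f s + h * eval R (deriv R f) s) + (h * h) * T
  eval-taylor []      s h = 0# , solve 1 (λ h → con (+ 0) := (con (+ 0) :+ h :* con (+ 0)) :+ (h :* h) :* con (+ 0)) refl h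
  eval-taylor (a ∷ f) s h with eval-taylor f s h
  ... | T , f[s+h]≈ = D + s * T + h * T , (begin
    a + (s + h) * eval R f (s + h)
      ≈⟨ +-congˡ (*-congˡ f[s+h]≈) ⟩
    a + (s + h) * ((F + h * D) + (h * h) * T)
      ≈⟨ solve 6 (λ a s h F D T → a :+ (s :+ h) :* ((F :+ h :* D) :+ (h :* h) :* T)
                   := ((a :+ s :* F) :+ h :* (con (+ 1) :* F :+ s :* D))
                      :+ (h :* h) :* (D :+ s :* T :+ h :* T))
               refl a s h F D T ⟩
    ((a + s * F) + h * ((1# + 0#) * F + s * D)) + (h * h) * (D + s * T + h * T)
      ≈⟨ +-congʳ (+-congˡ (*-congˡ (sym (eval-derivFrom 1 f s)))) ⟩
    ((a + s * F) + h * eval R (derivFrom R 1 f) s) + (h * h) * (D + s * T + h * T) ∎)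
    where
    F = eval R f s
    D = eval R (deriv R f) s

  eval-sub : ∀ f x y → ∃ λ T →
    eval R f x - eval R f y ≈ (eval R (deriv R f) y + (x - y) * T) * (x - y)
  eval-sub f x y with eval-taylor f y (x - y)
  ... | T , f[y+h]≈ = T , (begin
    eval R f x - F                             ≈⟨ +-congʳ (eval-cong f (sym y+[x-y]≈x)) ⟩
    eval R f (y + (x - y)) - F                 ≈⟨ +-congʳ f[y+h]≈ ⟩
    ((F + h * D) + (h * h) * T) - F            ≈⟨ solve 4 (λ F h D T → ((F :+ h :* D) :+ (h :* h) :* T) :- F
                                                               := (D :+ h :* T) :* h) refl F h D T ⟩
    (D + h * T) * h                            ∎)
    where
    F = eval R f y
    D = eval R (deriv R f) y
    h = x - y
    y+[x-y]≈x : y + (x - y) ≈ x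
    y+[x-y]≈x = solve 2 (λ x y → y :+ (x :- y) := x) refl x y

  eval-Cong : ∀ f {m x y} → Cong R x y m → Cong R (eval R f x) (eval R f y) m
  eval-Cong f {x = x} {y} m∣x-y with eval-sub f x y
  ... | T , f[x]-f[y]≈ = ∣ʳ-respʳ-≈ (sym f[x]-f[y]≈) (x∣ʳy⇒x∣ʳzy _ m∣x-y)

  eval-Cong-critical : ∀ f {m x y} → Cong R x y m → Cong R (eval R (deriv R f) y) 0# m →
                       Cong R (eval R f x) (eval R f y) (m ^ 2)
  eval-Cong-critical f {m} {x} {y} m∣x-y f′y≡0 with eval-sub f x y
  ... | T , f[x]-f[y]≈ = ∣ʳ-respʳ-≈ (sym f[x]-f[y]≈) (∣ʳ-respˡ-≈ m*m≈m^2 m²∣)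
    where
    m*m≈m^2 : m * m ≈ m ^ 2
    m*m≈m^2 = *-congˡ (sym (*-identityʳ m))
    m²∣ : m * m ∣ (eval R (deriv R f) y + (x - y) * T) * (x - y)
    m²∣ = x∣a∧y∣b⇒xy∣ab (∣x∣y⇒∣x+y (Cong-0⇒∣ f′y≡0) (∣x⇒∣xy T m∣x-y)) m∣x-y

  hensel-step : ∀ f {m e x s} k → Cong R (e * eval R (deriv R f) s) 1# m →
                Cong R x (eval R f s) (m ^ ℕ.suc k) →
                ∃ λ s′ → Cong R s′ s m × Cong R x (eval R f s′) (m ^ ℕ.suc (ℕ.suc k))
  hensel-step f {m} {e} {x} {s} k m∣eD-1 (u , uP≈x-F) with eval-taylor f s ((u * e) * (m ^ ℕ.suc k))
  ... | T , f[s+h]≈ = s + h , s+h≡s , ∣ʳ-respʳ-≈ (sym x-f[s+h]≈) (∣x∣y⇒∣x-y mP∣[u-tD]P mP∣hhT)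
    where
    Q = m ^ k
    P = m ^ ℕ.suc k
    t = u * e
    h = t * P
    F = eval R f s
    D = eval R (deriv R f) s

    s+h≡s : Cong R (s + h) s m
    s+h≡s = ∣ʳ-respʳ-≈ (solve 2 (λ s h → h := (s :+ h) :- s) refl s h) (x∣ʳy⇒x∣ʳzy t (x∣x^[1+k] m k))

    mP∣[u-tD]P : m * P ∣ (u - t * D) * P
    mP∣[u-tD]P = x∣ʳy⇒xz∣ʳyz P (∣ʳ-respʳ-≈ u-tD≈ (x∣ʳy⇒x∣ʳzy (- u) m∣eD-1))
      where
      u-tD≈ : (- u) * (e * D - 1#) ≈ u - t * D
      u-tD≈ = trans (solve 4 (λ u e D o → (:- u) :* (e :* D :- o) := u :* o :- (u :* e) :* D) refl u e D 1#)
                    (+-congʳ (*-identityʳ u))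

    mP∣hhT : m * P ∣ (h * h) * T
    mP∣hhT = ((t * t) * T) * Q ,
      solve 4 (λ t T m Q → (((t :* t) :* T) :* Q) :* (m :* (m :* Q))
                           := ((t :* (m :* Q)) :* (t :* (m :* Q))) :* T) refl t T m Q

    x-f[s+h]≈ : x - eval R f (s + h) ≈ (u - t * D) * P - (h * h) * T
    x-f[s+h]≈ = begin
      x - eval R f (s + h)                 ≈⟨ +-congˡ (-‿cong f[s+h]≈) ⟩
      x - ((F + h * D) + (h * h) * T)      ≈⟨ solve 5 (λ x F h D X → x :- ((F :+ h :* D) :+ X)
                                                                  := ((x :- F) :- h :* D) :- X)
                                                      refl x F h D ((h * h) * T) ⟩
      ((x - F) - h * D) - (h * h) * T      ≈⟨ +-congʳ (+-congʳ (sym uP≈x-F)) ⟩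
      (u * P - h * D) - (h * h) * T        ≈⟨ +-congʳ (solve 4 (λ u e P D → u :* P :- ((u :* e) :* P) :* D
                                                                    := (u :- (u :* e) :* D) :* P)
                                                        refl u e P D) ⟩
      (u - t * D) * P - (h * h) * T        ∎

  hensel-lift : ∀ f {m e x b} → Cong R (e * eval R (deriv R f) b) 1# m → Cong R x (eval R f b) m →
                ∀ k → ∃ λ s → Cong R s b m × Cong R x (eval R f s) (m ^ ℕ.suc k)
  hensel-lift f {m} {e} {x} {b} eD≡1 x≡fb ℕ.zero = b , Cong-refl , ∣ʳ-respˡ-≈ (sym (*-identityʳ m)) x≡fb
  hensel-lift f {m} {e} {x} {b} eD≡1 x≡fb (ℕ.suc k) = lift-once (hensel-lift f eD≡1 x≡fb k)
    where
    lift-once : (∃ λ s → Cong R s b m × Cong R x (eval R f s) (m ^ ℕ.suc k)) →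
                ∃ λ s → Cong R s b m × Cong R x (eval R f s) (m ^ ℕ.suc (ℕ.suc k))
    lift-once (s , s≡b , x≡fs) =
      let eD[s]≡1 = Cong-trans (Cong-*ˡ e (eval-Cong (deriv R f) s≡b)) eD≡1
          (s′ , s′≡s , x≡fs′) = hensel-step f k eD[s]≡1 x≡fs
      in s′ , Cong-trans s′≡s s≡b , x≡fs′

module PrimeModulus {c ℓ : Level} (R : CommutativeRing c ℓ) (pid : IsPID R)
                    {π : CommutativeRing.Carrier R} (prime : GeneratesPrimeIdeal R π) where
  open CommutativeRing R
  open import Algebra.Definitions.RawSemiring (Semiring.rawSemiring semiring) using (_∣_)
  open import Algebra.Properties.Semiring.Divisibility semiring using (_,_; ∣ʳ-trans; ∣ʳ-reflexive)
  open import Relation.Binary.Reasoning.Setoid setoid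
  open IntegerCoefficientSolver R using (solve; _:=_; _:+_; _:-_; _:*_; :-_; con)
  open CongruenceProperties R using (∣⇒Cong-0; x-0≈x)
  open IsPID pid using (principal; noZeroDiv)

  Span₂ : Carrier → Carrier → Carrier → Set (c ⊔ ℓ)
  Span₂ a b y = ∃₂ λ r t → y ≈ r * a + t * b

  Span₂-isIdeal : ∀ a b → IsIdeal R (Span₂ a b)
  Span₂-isIdeal a b = record
    { resp     = λ { y≈z (r , t , y≈) → r , t , trans (sym y≈z) y≈ }
    ; zero∈    = 0# , 0# , solve 2 (λ a b → con (+ 0) := con (+ 0) :* a :+ con (+ 0) :* b) refl a b
    ; +-closed = λ { (r , t , y≈) (r′ , t′ , z≈) → r + r′ , t + t′ , trans (+-cong y≈ z≈)
        (solve 6 (λ r t r′ t′ a b → (r :* a :+ t :* b) :+ (r′ :* a :+ t′ :* b) := (r :+ r′) :* a :+ (t :+ t′) :* b)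
               refl r t r′ t′ a b) }
    ; *-closed = λ { z (r , t , y≈) → z * r , z * t , trans (*-congˡ y≈)
        (solve 5 (λ z r t a b → z :* (r :* a :+ t :* b) := (z :* r) :* a :+ (z :* t) :* b) refl z r t a b) }
    }

  -- (π, d) = (g) with π = h g; primality puts π in (h) or in (g) ∋ d, and the domain
  -- property turns π ∣ h into π = 0 or g a unit, i.e. 1 ∈ (π, d).
  invertible-mod-prime : ∀ {d} → ¬ Cong R d 0# π → π ≈ 0# ⊎ ∃ λ e → Cong R (e * d) 1# π
  invertible-mod-prime {d} d≢0 with principal (Span₂ π d) (Span₂-isIdeal π d)
  ... | g , gen with proj₁ (gen π) (1# , 0# , π∈) | proj₁ (gen d) (0# , 1# , d∈)
    where
    π∈ = sym (trans (+-cong (*-identityˡ π) (zeroˡ d)) (+-identityʳ π))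
    d∈ = sym (trans (+-cong (zeroˡ π) (*-identityˡ d)) (+-identityˡ d))
  ... | h , hg≈π | g∣d with GeneratesPrimeIdeal.split prime (∣ʳ-reflexive (sym hg≈π))
  ... | inj₂ π∣g = ⊥-elim (d≢0 (∣⇒Cong-0 (∣ʳ-trans π∣g g∣d)))
  ... | inj₁ (w , wπ≈h) with noZeroDiv π[1-wg]≈0
    where
    π[1-wg]≈0 : π * (1# - w * g) ≈ 0#
    π[1-wg]≈0 = begin
      π * (1# - w * g)     ≈⟨ solve 4 (λ π w g o → π :* (o :- w :* g) := π :* o :- (w :* π) :* g) refl π w g 1# ⟩
      π * 1# - (w * π) * g ≈⟨ +-congʳ (*-identityʳ π) ⟩
      π - (w * π) * g      ≈⟨ +-congˡ (-‿cong (trans (*-congʳ wπ≈h) hg≈π)) ⟩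
      π - π                ≈⟨ -‿inverseʳ π ⟩
      0#                   ∎
  ... | inj₁ π≈0     = inj₁ π≈0
  ... | inj₂ 1-wg≈0 with proj₂ (gen 1#) (w , wg≈1)
    where
    wg≈1 : w * g ≈ 1#
    wg≈1 = trans (solve 3 (λ w g o → w :* g := o :- (o :- w :* g)) refl w g 1#)
                 (trans (+-congˡ (-‿cong 1-wg≈0)) (x-0≈x 1#))
  ... | r , t , 1≈rπ+td = inj₂ (t , (- r , (begin
    (- r) * π                     ≈⟨ solve 4 (λ r t π d → (:- r) :* π := t :* d :- (r :* π :+ t :* d)) refl r t π d ⟩
    t * d - (r * π + t * d)       ≈⟨ +-congˡ (-‿cong (sym 1≈rπ+td)) ⟩
    t * d - 1#                    ∎)))

module RepresentativeSystem {c ℓ : Level} (R : CommutativeRing c ℓ) {π : CommutativeRing.Carrier R}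
                            {q : ℕ} {C : Fin q → CommutativeRing.Carrier R}
                            (rep : IsCompleteRepSystem R π C) where
  open CongruenceProperties R using (Cong-sym; Cong-trans)
  open IsCompleteRepSystem rep

  rep-unique : ∀ {x i j} → Cong R x (C i) π → Cong R x (C j) π → i ≡ j
  rep-unique x≡Ci x≡Cj = distinct _ _ (Cong-trans (Cong-sym x≡Ci) x≡Cj)

  Cong-dec : ∀ x y → Dec (Cong R x y π)
  Cong-dec x y with complete x | complete y
  ... | i , x≡Ci | j , y≡Cj with i ≟ᶠ j
  ... | yes ≡.refl = yes (Cong-trans x≡Ci (Cong-sym y≡Cj))
  ... | no i≢j     = no λ x≡y → i≢j (rep-unique x≡Ci (Cong-trans x≡y y≡Cj))

module Closure {c ℓ : Level} (R : CommutativeRing c ℓ) (pid : IsPID R)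
               {π : CommutativeRing.Carrier R} (prime : GeneratesPrimeIdeal R π)
               {q : ℕ} {C : Fin q → CommutativeRing.Carrier R} (rep : IsCompleteRepSystem R π C)
               (f : Poly R) where
  open CommutativeRing R
  open import Algebra.Definitions.RawSemiring (Semiring.rawSemiring semiring) using (_^_)
  open CongruenceProperties R
  open PrimeModulus R pid prime using (invertible-mod-prime)
  open RepresentativeSystem R rep using (Cong-dec)
  open IsCompleteRepSystem rep using (complete)
  open Setup R π C f

  InS⇒InClosure : ∀ {i x} → InS i → Cong R x (C i) π → InClosure x
  InS⇒InClosure {x = x} (b , fb≡Ci , f′b≢0) x≡Ci (ℕ.suc k) _ = approximate (invertible-mod-prime f′b≢0)
    where
    x≡fb : Cong R x (eval R f b) π
    x≡fb = Cong-trans x≡Ci (Cong-sym fb≡Ci)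

    approximate : π ≈ 0# ⊎ ∃ (λ e → Cong R (e * eval R (deriv R f) b) 1# π) →
                  ∃ λ s → Cong R x (eval R f s) (π ^ ℕ.suc k)
    approximate (inj₁ π≈0)          = b , Cong-modulus≈0 (π ^ ℕ.suc k) π≈0 x≡fb
    approximate (inj₂ (e , ef′b≡1)) = let (s , _ , x≡fs) = hensel-lift f ef′b≡1 x≡fb k in s , x≡fs

  InBlock⇒Cong : ∀ {i x} → InBlock i x → Cong R x (C i) π
  InBlock⇒Cong (j , fCj≡Ci , x≡fCj) = Cong-trans (Cong-^⇒Cong 1 x≡fCj) fCj≡Ci

  InE⇒InBlock : ∀ {x} → InE x → ∃ λ i → (InS⁻ i × ¬ InS i) × InBlock i x
  InE⇒InBlock {x} (x∈cl , x∉S) =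
    let (s , x≡fs) = x∈cl 2 (ℕ.s≤s ℕ.z≤n)
        (i , x≡Ci) = complete x
        fs≡Ci      = Cong-trans (Cong-sym (Cong-^⇒Cong 1 x≡fs)) x≡Ci
    in classify s i x≡fs x≡Ci fs≡Ci (Cong-dec (eval R (deriv R f) s) 0#)
    where
    classify : ∀ s i → Cong R x (eval R f s) (π ^ 2) → Cong R x (C i) π → Cong R (eval R f s) (C i) π →
             Dec (Cong R (eval R (deriv R f) s) 0# π) → ∃ λ i → (InS⁻ i × ¬ InS i) × InBlock i x
    classify s i _    x≡Ci fs≡Ci (no f′s≢0)  = ⊥-elim (x∉S (i , (s , fs≡Ci , f′s≢0) , x≡Ci))
    classify s i x≡fs x≡Ci fs≡Ci (yes f′s≡0) =
      let (j , s≡Cj) = complete s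
          fCj≡Ci     = Cong-trans (eval-Cong f (Cong-sym s≡Cj)) fs≡Ci
          f′Cj≡0     = Cong-trans (eval-Cong (deriv R f) (Cong-sym s≡Cj)) f′s≡0
      in i , ((s , fs≡Ci , f′s≡0) , λ i∈S → x∉S (i , i∈S , x≡Ci))
           , (j , fCj≡Ci , Cong-trans x≡fs (eval-Cong-critical f s≡Cj f′Cj≡0))

corollary2p3 : ∀ {c ℓ : Level} (R : CommutativeRing c ℓ) → IsPID R →
    (π : CommutativeRing.Carrier R) → GeneratesPrimeIdeal R π →
    {q : ℕ} (C : Fin q → CommutativeRing.Carrier R) → IsCompleteRepSystem R π C →
    (f : Poly R) →
    let open Setup R π C f in
    -- the union over a ∈ S of (a + p) is disjoint
    (∀ i j x → InS i → InS j → Cong R x (C i) π → Cong R x (C j) π → i ≡ j)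
    -- ⊔_{a ∈ S} (a + p) ⊆ closure of f(R)
    × (∀ i x → InS i → Cong R x (C i) π → InClosure x)
    -- the union over a ∈ S⁻ ∖ S is disjoint
    × (∀ i j x → (InS⁻ i × ¬ InS i) → (InS⁻ j × ¬ InS j) → InBlock i x → InBlock j x → i ≡ j)
    -- E ⊆ ⊔_{a ∈ S⁻ ∖ S} ⋃_{b ∈ C, f(b) ≡ a} (f(b) + p²)
    × (∀ x → InE x → ∃ λ i → (InS⁻ i × ¬ InS i) × InBlock i x)
corollary2p3 R pid π prime C rep f =
    (λ _ _ _ _ _ → rep-unique)
  , (λ _ _ → InS⇒InClosure)
  , (λ _ _ _ _ _ x∈Bi x∈Bj → rep-unique (InBlock⇒Cong x∈Bi) (InBlock⇒Cong x∈Bj))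
  , (λ _ → InE⇒InBlock)
  where
  open RepresentativeSystem R rep using (rep-unique)
  open Closure R pid prime rep f using (InS⇒InClosure; InBlock⇒Cong; InE⇒InBlock)
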